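{- A connected finite graph $G$ of genus at least $2$ contains a unique subgraph of the same genus which is edge-walk-connected.
   Context: $G$: connected finite graph (multiple edges, loops allowed), genus $g=m-n+1$ ($n$ vertices, $m$ edges). Oriented edges $\mathbf a$ have initial/terminal vertices $\mathbf a(0),\mathbf a(1)$ and inverses $\mathbf a^{ -1}$. An edge-walk is a sequence of oriented edges $\mathbf a_0\mathbf a_1\cdots\mathbf a_N$ with $\mathbf a_{i+1}(0)=\mathbf a_i(1)$; it is non-backtracking if $\mathbf a_{i+1}\ne\mathbf a_i^{ -1}$ for all $i$; it goes from $\mathbf a_0$ to $\mathbf a_N$. A graph is edge-walk-connected if for every pair of (not necessarily distinct) oriented edges $\mathbf e,\mathbf e'$ there is a non-backtracking edge-walk from $\mathbf e$ to $\mathbf e'$. -}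

module Defs where

open import Data.Nat using (ℕ)
open import Data.Bool using (Bool; true; false; not)
open import Data.Fin using (Fin)
open import Data.Fin.Subset using (Subset; _∈_; ∣_∣; ⊤)
open import Data.Integer using (ℤ; +_; _-_; _+_)
open import Data.Product using (_×_; _,_; proj₁; proj₂; Σ; ∃)
open import Relation.Binary.PropositionalEquality using (_≡_; _≢_)

-- A finite graph: vertices Fin nV, edges Fin nE, each edge has an (ordered
-- for bookkeeping) pair of endpoints. Loops and multiple edges are allowed.
record Graph : Set where
  field
    nV : ℕ
    nE : ℕ
    ends : Fin nE → Fin nV × Fin nV
open Graph public

-- Oriented edges: (e , false) is e in its reference orientation,
-- (e , true) is its inverse.
OEdge : Graph → Set
OEdge G = Fin (nE G) × Bool

edgeOf : {G : Graph} → OEdge G → Fin (nE G)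
edgeOf = proj₁

inv : {G : Graph} → OEdge G → OEdge G
inv (e , b) = (e , not b)

init : (G : Graph) → OEdge G → Fin (nV G)
init G (e , false) = proj₁ (ends G e)
init G (e , true)  = proj₂ (ends G e)

term : (G : Graph) → OEdge G → Fin (nV G)
term G (e , false) = proj₂ (ends G e)
term G (e , true)  = proj₁ (ends G e)

record Subgraph (G : Graph) : Set where
  constructor sub
  field
    verts : Subset (nV G)
    edges : Subset (nE G)
open Subgraph public

IsSubgraph : {G : Graph} → Subgraph G → Set
IsSubgraph {G} S = ∀ e → e ∈ edges S →
  (proj₁ (ends G e) ∈ verts S) × (proj₂ (ends G e) ∈ verts S)

whole : (G : Graph) → Subgraph G
whole G = sub ⊤ ⊤

data Walk {G : Graph} (S : Subgraph G) : Fin (nV G) → Fin (nV G) → Set where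
  here : ∀ {v} → Walk S v v
  step : ∀ {v} (a : OEdge G) → edgeOf {G} a ∈ edges S →
         Walk S (term G a) v → Walk S (init G a) v

Connected : {G : Graph} → Subgraph G → Set
Connected {G} S =
  (∃ λ v → v ∈ verts S) ×
  (∀ u v → u ∈ verts S → v ∈ verts S → Walk S u v)

genus : {G : Graph} → Subgraph G → ℤ
genus S = (+ ∣ edges S ∣ - + ∣ verts S ∣) + + 1

data NBWalk {G : Graph} (S : Subgraph G) : OEdge G → OEdge G → Set where
  single : ∀ (a : OEdge G) → edgeOf {G} a ∈ edges S → NBWalk S a a
  cons   : ∀ (a b : OEdge G) {c} → edgeOf {G} a ∈ edges S → init G b ≡ term G a →
           b ≢ inv {G} a → NBWalk S b c → NBWalk S a c

EdgeWalkConnected : {G : Graph} → Subgraph G → Set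
EdgeWalkConnected {G} S = ∀ (a b : OEdge G) →
  edgeOf {G} a ∈ edges S → edgeOf {G} b ∈ edges S → NBWalk S a b

GoodSub : (G : Graph) → Subgraph G → Set
GoodSub G S = IsSubgraph S × Connected S ×
  (genus S ≡ genus (whole G)) × EdgeWalkConnected S

{-# OPTIONS --safe #-}

-- Deleting a vertex of degree one together with its edge preserves connectivity and the genus,
-- and never touches an edge-walk-connected subgraph of full genus, because such a subgraph has
-- minimum degree two. Pruning G in this way ends in a connected subgraph H of full genus and
-- minimum degree two. In H every oriented edge a can be turned around by a non-backtracking walk:
-- continue from a without backtracking until some vertex is entered for the second time. If it
-- is entered by two different edges, the walk can turn back there. If the same edge repeats, the
-- walk contains a closed non-backtracking walk; from it every edge of H is reached in some
-- orientation, and since H has more edges than vertices, two of these reached edges enter a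
-- common vertex, where the walk turns back. Since every oriented edge can be turned around,
-- any two oriented edges of H are joined by a non-backtracking walk.
-- For uniqueness, a subgraph K of H with a vertex but not all of H has smaller genus than H:
-- adding an edge of H that leaves K either closes a cycle, raising the genus, or attaches a new
-- vertex, keeping it, and minimum degree two at that new vertex shows that the enlarged graph
-- is still not all of H.
module Submission where

open import Defs
open import Data.Bool using (Bool; true; false)
import Data.Bool.Properties as Bool
open import Data.Fin using (Fin; zero; suc; toℕ)
import Data.Fin.Properties as Fin
open import Data.Fin.Subset using (Subset; _∈_; _∉_; _⊆_; ∣_∣; Nonempty; inside; outside)
open import Data.Fin.Subset.Properties using (_∈?_; ∈⊤; ⊆-antisym; p⊆q⇒∣p∣≤∣q∣)
open import Data.Integer as ℤ using (ℤ; +_; _-_; _≤_)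
import Data.Integer.Properties as ℤ
open import Data.Integer.Tactic.RingSolver using (solve-∀)
open import Data.Nat as ℕ using (ℕ; zero; suc; _∸_; _<_; _≤′_; s≤s)
import Data.Nat.Properties as ℕ
open import Data.Nat.Induction using (<-wellFounded)
open import Data.Product as Product using (Σ; ∃; ∃₂; _×_; _,_; proj₁; proj₂)
open import Data.Product.Properties using (≡-dec)
open import Data.Sum using (_⊎_; inj₁; inj₂; [_,_]′)
open import Data.Vec using (_∷_; here; there; _[_]≔_)
open import Data.Vec.Properties
  using ([]≔-minimal; []≔-updates; []≔-lookup; []≔-idempotent; []=-injective; []=⇒lookup; lookup⇒[]=)
open import Function using (_∘_)
open import Induction.WellFounded using (Acc; acc)
open import Relation.Binary.PropositionalEquality
open import Relation.Nullary using (¬_; Dec; yes; no; contradiction)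
open import Relation.Nullary.Decidable using (_×-dec_; _⊎-dec_; ¬?; decidable-stable)

private variable
  n : ℕ
  p q : Subset n
  x y : Fin n

∣p[x]≔inside∣≡suc∣p[x]≔outside∣ : ∀ (p : Subset n) x → ∣ p [ x ]≔ inside ∣ ≡ suc ∣ p [ x ]≔ outside ∣
∣p[x]≔inside∣≡suc∣p[x]≔outside∣ (_ ∷ p) zero = refl
∣p[x]≔inside∣≡suc∣p[x]≔outside∣ (inside ∷ p) (suc x) =
  cong suc (∣p[x]≔inside∣≡suc∣p[x]≔outside∣ p x)
∣p[x]≔inside∣≡suc∣p[x]≔outside∣ (outside ∷ p) (suc x) = ∣p[x]≔inside∣≡suc∣p[x]≔outside∣ p x

x∈p⇒p[x]≔inside≡p : x ∈ p → p [ x ]≔ inside ≡ p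
x∈p⇒p[x]≔inside≡p {x = x} {p = p} x∈p =
  subst (λ b → p [ x ]≔ b ≡ p) ([]=⇒lookup x∈p) ([]≔-lookup p x)

x∉p⇒p[x]≔outside≡p : x ∉ p → p [ x ]≔ outside ≡ p
x∉p⇒p[x]≔outside≡p {x = x} {p = p} x∉p =
  subst (λ b → p [ x ]≔ b ≡ p) (Bool.¬-not (x∉p ∘ lookup⇒[]= x p)) ([]≔-lookup p x)

x∈p⇒∣p∣≡suc∣p[x]≔outside∣ : x ∈ p → ∣ p ∣ ≡ suc ∣ p [ x ]≔ outside ∣
x∈p⇒∣p∣≡suc∣p[x]≔outside∣ {x = x} {p = p} x∈p =
  trans (cong ∣_∣ (sym (x∈p⇒p[x]≔inside≡p x∈p))) (∣p[x]≔inside∣≡suc∣p[x]≔outside∣ p x)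

x∉p⇒∣p[x]≔inside∣≡suc∣p∣ : x ∉ p → ∣ p [ x ]≔ inside ∣ ≡ suc ∣ p ∣
x∉p⇒∣p[x]≔inside∣≡suc∣p∣ {x = x} {p = p} x∉p =
  trans (∣p[x]≔inside∣≡suc∣p[x]≔outside∣ p x) (cong (suc ∘ ∣_∣) (x∉p⇒p[x]≔outside≡p x∉p))

x∈p[y]≔b∧x≢y⇒x∈p : ∀ {b} → x ∈ p [ y ]≔ b → x ≢ y → x ∈ p
x∈p[y]≔b∧x≢y⇒x∈p {x = x} {p = p} {y = y} x∈ x≢y =
  subst (x ∈_) (trans ([]≔-idempotent p y) ([]≔-lookup p y)) ([]≔-minimal _ x y x≢y x∈)

x∈p[y]≔outside⇒x≢y : x ∈ p [ y ]≔ outside → x ≢ y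
x∈p[y]≔outside⇒x≢y {p = p} x∈ refl with () ← []=-injective x∈ ([]≔-updates p _)

x∈p[y]≔outside⇒x∈p : x ∈ p [ y ]≔ outside → x ∈ p
x∈p[y]≔outside⇒x∈p x∈ = x∈p[y]≔b∧x≢y⇒x∈p x∈ (x∈p[y]≔outside⇒x≢y x∈)

x∈p[y]≔inside⇒x≡y⊎x∈p : x ∈ p [ y ]≔ inside → x ≡ y ⊎ x ∈ p
x∈p[y]≔inside⇒x≡y⊎x∈p {x = x} {y = y} x∈ with x Fin.≟ y
... | yes x≡y = inj₁ x≡y
... | no x≢y = inj₂ (x∈p[y]≔b∧x≢y⇒x∈p x∈ x≢y)

p⊆p[x]≔inside : p ⊆ p [ x ]≔ inside
p⊆p[x]≔inside {p = p} {x = x} {y} y∈ with y Fin.≟ x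
... | yes refl = []≔-updates p x
... | no y≢x = []≔-minimal p y x y≢x y∈

p⊆q⊎∃∈p∉q : ∀ (p q : Subset n) → p ⊆ q ⊎ ∃ λ x → x ∈ p × x ∉ q
p⊆q⊎∃∈p∉q p q with Fin.any? (λ x → (x ∈? p) ×-dec ¬? (x ∈? q))
... | yes witness = inj₂ witness
... | no none = inj₁ λ {x} x∈p → decidable-stable (x ∈? q) (λ x∉q → none (x , x∈p , x∉q))

0<∣p∣⇒nonempty : 0 < ∣ p ∣ → Nonempty p
0<∣p∣⇒nonempty {p = inside ∷ p} _ = zero , here
0<∣p∣⇒nonempty {p = outside ∷ p} 0<∣p∣ = Product.map suc there (0<∣p∣⇒nonempty 0<∣p∣)

subset-pigeonhole : ∀ {m} {p : Subset m} (f : Fin m → Fin n) →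
  (∀ i → i ∈ p → f i ∈ q) → ∣ q ∣ < ∣ p ∣ →
  ∃₂ λ i j → i ∈ p × j ∈ p × i ≢ j × f i ≡ f j
subset-pigeonhole {p = outside ∷ p} f f∈q q<p
  with i , j , i∈ , j∈ , i≢j , fi≡fj ← subset-pigeonhole (f ∘ suc) (λ i → f∈q (suc i) ∘ there) q<p
  = suc i , suc j , there i∈ , there j∈ , i≢j ∘ Fin.suc-injective , fi≡fj
subset-pigeonhole {q = q} {p = inside ∷ p} f f∈q q<p
  with Fin.any? (λ i → (i ∈? p) ×-dec (f (suc i) Fin.≟ f zero))
... | yes (i , i∈ , fi≡f0) = suc i , zero , there i∈ , here , (λ ()) , fi≡f0
... | no f0-unique
  with i , j , i∈ , j∈ , i≢j , fi≡fj ← subset-pigeonhole {q = q [ f zero ]≔ outside} (f ∘ suc)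
         (λ i i∈ → []≔-minimal q _ _ (λ fi≡f0 → f0-unique (i , i∈ , fi≡f0)) (f∈q (suc i) (there i∈)))
         (subst (ℕ._≤ _) (x∈p⇒∣p∣≡suc∣p[x]≔outside∣ (f∈q zero here)) (ℕ.s≤s⁻¹ q<p))
  = suc i , suc j , there i∈ , there j∈ , i≢j ∘ Fin.suc-injective , fi≡fj

-- genus S unfolds to cyclomatic ∣ edges S ∣ ∣ verts S ∣.
cyclomatic : ℕ → ℕ → ℤ
cyclomatic m n = (+ m - + n) ℤ.+ + 1

-- The solver identities below apply because + suc m is definitionally + 1 ℤ.+ + m.
cyclomatic-sucˡ : ∀ m n → cyclomatic (suc m) n ≡ ℤ.suc (cyclomatic m n)
cyclomatic-sucˡ m n = shift (+ m) (+ n)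
  where
  shift : ∀ i j → ((+ 1 ℤ.+ i) - j) ℤ.+ + 1 ≡ + 1 ℤ.+ ((i - j) ℤ.+ + 1)
  shift = solve-∀

cyclomatic-suc : ∀ m n → cyclomatic (suc m) (suc n) ≡ cyclomatic m n
cyclomatic-suc m n = shift (+ m) (+ n)
  where
  shift : ∀ i j → ((+ 1 ℤ.+ i) - (+ 1 ℤ.+ j)) ℤ.+ + 1 ≡ (i - j) ℤ.+ + 1
  shift = solve-∀

2≤cyclomatic⇒< : ∀ m n → + 2 ≤ cyclomatic m n → n < m
2≤cyclomatic⇒< m n 2≤χ = ℕ.s≤s⁻¹ (ℤ.drop‿+≤+ (begin
  + 2 ℤ.+ + n             ≤⟨ ℤ.+-monoˡ-≤ (+ n) 2≤χ ⟩
  cyclomatic m n ℤ.+ + n  ≡⟨ cancel (+ m) (+ n) ⟩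
  + 1 ℤ.+ + m             ∎))
  where
  open ℤ.≤-Reasoning
  cancel : ∀ i j → ((i - j) ℤ.+ + 1) ℤ.+ j ≡ + 1 ℤ.+ i
  cancel = solve-∀

module _ (G : Graph) where

  private variable
    a b c d : OEdge G
    e : Fin (nE G)
    u v w : Fin (nV G)
    S K H : Subgraph G

  infix 10 _⁻¹
  infix 4 _∈ₑ_ _⊑_ _≟ₒ_

  _⁻¹ : OEdge G → OEdge G
  _⁻¹ = inv {G}

  edge : OEdge G → Fin (nE G)
  edge = edgeOf {G}

  _∈ₑ_ : OEdge G → Subgraph G → Set
  a ∈ₑ S = edge a ∈ edges S

  ⁻¹-involutive : ∀ a → a ⁻¹ ⁻¹ ≡ a
  ⁻¹-involutive (_ , false) = refl
  ⁻¹-involutive (_ , true) = refl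

  init-⁻¹ : ∀ a → init G (a ⁻¹) ≡ term G a
  init-⁻¹ (_ , false) = refl
  init-⁻¹ (_ , true) = refl

  term-⁻¹ : ∀ a → term G (a ⁻¹) ≡ init G a
  term-⁻¹ (_ , false) = refl
  term-⁻¹ (_ , true) = refl

  a≢a⁻¹ : ∀ a → a ≢ a ⁻¹
  a≢a⁻¹ (_ , false) ()
  a≢a⁻¹ (_ , true) ()

  same-edge : ∀ a b → edge b ≡ edge a → b ≡ a ⊎ b ≡ a ⁻¹
  same-edge (_ , false) (_ , false) refl = inj₁ refl
  same-edge (_ , false) (_ , true) refl = inj₂ refl
  same-edge (_ , true) (_ , false) refl = inj₂ refl
  same-edge (_ , true) (_ , true) refl = inj₁ refl

  _≟ₒ_ : (a b : OEdge G) → Dec (a ≡ b)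
  _≟ₒ_ = ≡-dec Fin._≟_ Bool._≟_

  any-oriented? : {P : OEdge G → Set} → (∀ a → Dec (P a)) → Dec (∃ P)
  any-oriented? P? with Fin.any? (λ e → P? (e , false) ⊎-dec P? (e , true))
  ... | yes (e , inj₁ Pa) = yes ((e , false) , Pa)
  ... | yes (e , inj₂ Pa) = yes ((e , true) , Pa)
  ... | no none = no λ where
    ((e , false) , Pa) → none (e , inj₁ Pa)
    ((e , true) , Pa) → none (e , inj₂ Pa)

  ends-∈ : IsSubgraph S → ∀ a → a ∈ₑ S → init G a ∈ verts S × term G a ∈ verts S
  ends-∈ S-sub (e , false) e∈ = S-sub e e∈
  ends-∈ S-sub (e , true) e∈ = Product.swap (S-sub e e∈)

  ∈-ends : ∀ {X : Subset (nV G)} a → init G a ∈ X → term G a ∈ X →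
    proj₁ (ends G (edge a)) ∈ X × proj₂ (ends G (edge a)) ∈ X
  ∈-ends (_ , false) init∈ term∈ = init∈ , term∈
  ∈-ends (_ , true) init∈ term∈ = term∈ , init∈

  _⊑_ : Subgraph G → Subgraph G → Set
  K ⊑ S = verts K ⊆ verts S × edges K ⊆ edges S

  ⊑-antisym : K ⊑ S → S ⊑ K → K ≡ S
  ⊑-antisym (V⊆ , E⊆) (V⊇ , E⊇) = cong₂ sub (⊆-antisym V⊆ V⊇) (⊆-antisym E⊆ E⊇)

  Follows : Subgraph G → OEdge G → OEdge G → Set
  Follows S b c = c ∈ₑ S × init G c ≡ term G b × c ≢ b ⁻¹

  module _ {S : Subgraph G} where

    infixl 6 _▷_
    infixr 5 _++_

    source-∈ : NBWalk S a b → a ∈ₑ S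
    source-∈ (single _ a∈) = a∈
    source-∈ (cons _ _ a∈ _ _ _) = a∈

    target-∈ : NBWalk S a b → b ∈ₑ S
    target-∈ (single _ a∈) = a∈
    target-∈ (cons _ _ _ _ _ w) = target-∈ w

    _▷_ : NBWalk S a b → Follows S b c → NBWalk S a c
    single a a∈ ▷ (c∈ , c↑ , c≢) = cons a _ a∈ c↑ c≢ (single _ c∈)
    cons a b a∈ b↑ b≢ w ▷ f = cons a b a∈ b↑ b≢ (w ▷ f)

    _++_ : NBWalk S a b → NBWalk S b c → NBWalk S a c
    single _ _ ++ w′ = w′
    cons a b a∈ b↑ b≢ w ++ w′ = cons a b a∈ b↑ b≢ (w ++ w′)

    reverse : NBWalk S a b → NBWalk S (b ⁻¹) (a ⁻¹)
    reverse (single a a∈) = single (a ⁻¹) a∈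
    reverse (cons a b a∈ b↑ b≢ w) = reverse w ▷ (a∈ , a⁻¹↑ , a⁻¹≢)
      where
      a⁻¹↑ : init G (a ⁻¹) ≡ term G (b ⁻¹)
      a⁻¹↑ = trans (init-⁻¹ a) (trans (sym b↑) (sym (term-⁻¹ b)))
      a⁻¹≢ : a ⁻¹ ≢ b ⁻¹ ⁻¹
      a⁻¹≢ eq = b≢ (trans (sym (⁻¹-involutive b)) (sym eq))

    unsnoc : NBWalk S a b → a ≡ b ⊎ ∃ λ b′ → NBWalk S a b′ × Follows S b′ b
    unsnoc (single _ _) = inj₁ refl
    unsnoc (cons a b a∈ b↑ b≢ w) with unsnoc w
    ... | inj₁ refl = inj₂ (a , single a a∈ , target-∈ w , b↑ , b≢)
    ... | inj₂ (b′ , w′ , f) = inj₂ (b′ , cons a b a∈ b↑ b≢ w′ , f)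

    first-step : NBWalk S a b → a ≢ b → ∃ (Follows S a)
    first-step (single _ _) a≢a = contradiction refl a≢a
    first-step (cons _ b _ b↑ b≢ w) _ = b , source-∈ w , b↑ , b≢

  Leaves : Subgraph G → Fin (nV G) → OEdge G → Set
  Leaves S v a = a ∈ₑ S × init G a ≡ v

  -- Degrees count leaving oriented edges, so a loop counts twice.
  Degree≥2 : Subgraph G → Fin (nV G) → Set
  Degree≥2 S v = ∃₂ λ a b → a ≢ b × Leaves S v a × Leaves S v b

  MinDegree≥2 : Subgraph G → Set
  MinDegree≥2 S = ∀ v → v ∈ verts S → Degree≥2 S v

  degree≥2? : ∀ S v → Dec (Degree≥2 S v)
  degree≥2? S v =
    any-oriented? λ a → any-oriented? λ b → ¬? (a ≟ₒ b) ×-dec leaves? a ×-dec leaves? b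
    where
    leaves? : ∀ a → Dec (Leaves S v a)
    leaves? a = (edge a ∈? edges S) ×-dec (init G a Fin.≟ v)

  leaving-along : Walk S u w → ∃ (Leaves S u) → ∃ (Leaves S w)
  leaving-along here l = l
  leaving-along (step c c∈ W) _ = leaving-along W (c ⁻¹ , c∈ , init-⁻¹ c)

  leaving-edge : ∀ S → IsSubgraph S → Connected S → e ∈ edges S → v ∈ verts S → ∃ (Leaves S v)
  leaving-edge {e} S S-sub S-conn e∈ v∈ =
    leaving-along (proj₂ S-conn _ _ (proj₁ (S-sub e e∈)) v∈) ((e , false) , e∈ , refl)

  -- A non-backtracking walk from a ⁻¹ to a leaves init G a along an edge other than a.
  edgeWalkConnected⇒minDegree≥2 : ∀ S → IsSubgraph S → Connected S → Nonempty (edges S) →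
    EdgeWalkConnected S → MinDegree≥2 S
  edgeWalkConnected⇒minDegree≥2 S S-sub S-conn (e , e∈) S-ewc v v∈
    with a , a∈ , a↑ ← leaving-edge S S-sub S-conn e∈ v∈
    with b , b∈ , b↑ , b≢ ← first-step (S-ewc (a ⁻¹) a a∈ a∈) (a≢a⁻¹ a ∘ sym)
    = a , b , (λ a≡b → b≢ (trans (sym a≡b) (sym (⁻¹-involutive a))))
    , (a∈ , a↑) , (b∈ , trans b↑ (trans (term-⁻¹ a) a↑))

  module _ {H : Subgraph G} (H-sub : IsSubgraph H) (H-conn : Connected H)
           (V<E : ∣ verts H ∣ < ∣ edges H ∣) where

    module _ {x z : OEdge G} (x⇝z : NBWalk H x z) (z→x : Follows H z x) where

      Reached : Fin (nV G) → Set
      Reached u = ∀ d → Leaves H u d → NBWalk H x d ⊎ NBWalk H x (d ⁻¹)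

      reached-term : NBWalk H x d → Reached (term G d)
      reached-term {d} x⇝d d′ (d′∈ , d′↑) with d′ ≟ₒ d ⁻¹
      ... | yes refl = inj₂ (subst (NBWalk H x) (sym (⁻¹-involutive d)) x⇝d)
      ... | no d′≢ = inj₁ (x⇝d ▷ (d′∈ , d′↑ , d′≢))

      -- Only the trivial walk from x needs the closing step z → x.
      reached-init : NBWalk H x d → Reached (init G d)
      reached-init x⇝d with unsnoc x⇝d
      ... | inj₁ refl = subst Reached (sym (proj₁ (proj₂ z→x))) (reached-term x⇝z)
      ... | inj₂ (d′ , x⇝d′ , _ , d↑ , _) = subst Reached (sym d↑) (reached-term x⇝d′)

      reached-along : Walk H u w → Reached u → Reached w
      reached-along here r = r
      reached-along (step c c∈ W) r with r c (c∈ , refl)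
      ... | inj₁ x⇝c = reached-along W (reached-term x⇝c)
      ... | inj₂ x⇝c⁻¹ = reached-along W (subst Reached (init-⁻¹ c) (reached-init x⇝c⁻¹))

      reached-everywhere : v ∈ verts H → Reached v
      reached-everywhere v∈ = reached-along (proj₂ H-conn _ _ x↓∈ v∈) (reached-term (single x x∈))
        where
        x∈ = source-∈ x⇝z
        x↓∈ = proj₂ (ends-∈ H-sub x x∈)

      reached-orientation : ∀ e → e ∈ edges H → Σ Bool λ β → NBWalk H x (e , β)
      reached-orientation e e∈ with reached-everywhere (proj₁ (H-sub e e∈)) (e , false) (e∈ , refl)
      ... | inj₁ x⇝e = false , x⇝e
      ... | inj₂ x⇝e⁻¹ = true , x⇝e⁻¹

      -- The value off H is irrelevant; pigeonhole wants a total function.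
      far-end : Fin (nE G) → Fin (nV G)
      far-end e with e ∈? edges H
      ... | yes e∈ = term G (e , proj₁ (reached-orientation e e∈))
      ... | no _ = init G x

      far-end-reached : ∀ e → e ∈ edges H →
        Σ Bool λ β → NBWalk H x (e , β) × term G (e , β) ≡ far-end e
      far-end-reached e e∈ with e ∈? edges H
      ... | yes e∈′ = proj₁ (reached-orientation e e∈′) , proj₂ (reached-orientation e e∈′) , refl
      ... | no e∉ = contradiction e∈ e∉

      far-end-∈ : ∀ e → e ∈ edges H → far-end e ∈ verts H
      far-end-∈ e e∈ with β , x⇝e , end ← far-end-reached e e∈ =
        subst (_∈ verts H) end (proj₂ (ends-∈ H-sub (e , β) (target-∈ x⇝e)))

      closed⇒reversible : NBWalk H x (x ⁻¹)
      closed⇒reversible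
        with i , j , i∈ , j∈ , i≢j , same-end ← subset-pigeonhole far-end far-end-∈ V<E
        with β , x⇝i , i-end ← far-end-reached i i∈
        with β′ , x⇝j , j-end ← far-end-reached j j∈
        = x⇝i ▷ (j∈ , trans (init-⁻¹ (j , β′)) (trans j-end (trans (sym same-end) (sym i-end))) ,
                 λ eq → i≢j (sym (cong edge eq)))
          ++ reverse x⇝j

    module _ (H-deg : MinDegree≥2 H) where

      continue : ∀ a → a ∈ₑ H → ∃ (Follows H a)
      continue a a∈ with H-deg (term G a) (proj₂ (ends-∈ H-sub a a∈))
      ... | b , b′ , b≢b′ , (b∈ , b↑) , (b′∈ , b′↑) with b ≟ₒ a ⁻¹
      ... | yes refl = b′ , b′∈ , b′↑ , b≢b′ ∘ sym
      ... | no b≢ = b , b∈ , b↑ , b≢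

      module _ (a : OEdge G) (a∈ : a ∈ₑ H) where

        trail : ℕ → OEdge G
        trail-∈ : ∀ k → trail k ∈ₑ H
        trail zero = a
        trail (suc k) = proj₁ (continue (trail k) (trail-∈ k))
        trail-∈ zero = a∈
        trail-∈ (suc k) = proj₁ (proj₂ (continue (trail k) (trail-∈ k)))

        trail-follows : ∀ k → Follows H (trail k) (trail (suc k))
        trail-follows k = proj₂ (continue (trail k) (trail-∈ k))

        trail-walk : ∀ {i j} → i ≤′ j → NBWalk H (trail i) (trail j)
        trail-walk {i} ℕ.≤′-refl = single (trail i) (trail-∈ i)
        trail-walk {j = suc j} (ℕ.≤′-step i≤j) = trail-walk i≤j ▷ trail-follows j

        trail-prefix : ∀ k → NBWalk H a (trail k)
        trail-prefix k = trail-walk (ℕ.z≤′n {k})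

        trail-meets : ∀ {i j} → i < j → term G (trail i) ≡ term G (trail j) → NBWalk H a (a ⁻¹)
        trail-meets {i} {suc j} (s≤s i≤j) same-end with trail i ≟ₒ trail (suc j)
        ... | yes same = trail-prefix i ++ closed⇒reversible cycle closing ++ reverse (trail-prefix i)
          where
          cycle = trail-walk (ℕ.≤⇒≤′ i≤j)
          closing = subst (Follows H (trail j)) (sym same) (trail-follows j)
        ... | no differ = trail-prefix (suc j) ▷ turn ++ reverse (trail-prefix i)
          where
          turn : Follows H (trail (suc j)) (trail i ⁻¹)
          turn = trail-∈ i , trans (init-⁻¹ (trail i)) same-end , λ eq → differ (begin
            trail i             ≡⟨ ⁻¹-involutive (trail i) ⟨
            trail i ⁻¹ ⁻¹       ≡⟨ cong _⁻¹ eq ⟩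
            trail (suc j) ⁻¹ ⁻¹ ≡⟨ ⁻¹-involutive (trail (suc j)) ⟩
            trail (suc j)       ∎)
            where open ≡-Reasoning

        reversible : NBWalk H a (a ⁻¹)
        reversible
          with i , j , i<j , same-end ← Fin.pigeonhole (ℕ.n<1+n (nV G)) (term G ∘ trail ∘ toℕ)
          = trail-meets i<j same-end

      adjacent⇒NBWalk : ∀ a b → a ∈ₑ H → b ∈ₑ H → init G b ≡ term G a → NBWalk H a b
      adjacent⇒NBWalk a b a∈ b∈ b↑ with b ≟ₒ a ⁻¹
      ... | yes refl = reversible a a∈
      ... | no b≢ = single a a∈ ▷ (b∈ , b↑ , b≢)

      walk⇒NBWalk : Walk H u w → ∀ a b → a ∈ₑ H → b ∈ₑ H → term G a ≡ u → init G b ≡ w →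
        NBWalk H a b
      walk⇒NBWalk here a b a∈ b∈ a↓ b↑ = adjacent⇒NBWalk a b a∈ b∈ (trans b↑ (sym a↓))
      walk⇒NBWalk (step c c∈ W) a b a∈ b∈ a↓ b↑ =
        adjacent⇒NBWalk a c a∈ c∈ (sym a↓) ++ walk⇒NBWalk W c b c∈ b∈ refl b↑

      minDegree≥2⇒edgeWalkConnected : EdgeWalkConnected H
      minDegree≥2⇒edgeWalkConnected a b a∈ b∈ = walk⇒NBWalk a↓⇝b↑ a b a∈ b∈ refl refl
        where
        a↓⇝b↑ = proj₂ H-conn _ _ (proj₂ (ends-∈ H-sub a a∈)) (proj₁ (ends-∈ H-sub b b∈))

  Pendant : Subgraph G → OEdge G → Set
  Pendant S a = a ∈ₑ S × ∀ b → Leaves S (init G a) b → b ≡ a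

  ¬degree≥2⇒pendant : ∀ (S : Subgraph G) → ¬ Degree≥2 S v → Leaves S v a → Pendant S a
  ¬degree≥2⇒pendant {a = a} S ¬deg (a∈ , refl) = a∈ , unique
    where
    unique : ∀ b → Leaves S (init G a) b → b ≡ a
    unique b b-leaves with b ≟ₒ a
    ... | yes b≡a = b≡a
    ... | no b≢a = contradiction (b , a , b≢a , b-leaves , (a∈ , refl)) ¬deg

  pendant-loopless : ∀ (S : Subgraph G) a → Pendant S a → term G a ≢ init G a
  pendant-loopless S a (a∈ , unique) a↓ = a≢a⁻¹ a (sym (unique (a ⁻¹) (a∈ , trans (init-⁻¹ a) a↓)))

  _⊖_ : Subgraph G → OEdge G → Subgraph G
  S ⊖ a = sub (verts S [ init G a ]≔ outside) (edges S [ edge a ]≔ outside)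

  ⊖-shrinks : ∀ (S : Subgraph G) a → init G a ∈ verts S → ∣ verts (S ⊖ a) ∣ < ∣ verts S ∣
  ⊖-shrinks S a a↑∈ = ℕ.≤-reflexive (sym (x∈p⇒∣p∣≡suc∣p[x]≔outside∣ a↑∈))

  ⊖-genus : ∀ (S : Subgraph G) a → init G a ∈ verts S → a ∈ₑ S → genus (S ⊖ a) ≡ genus S
  ⊖-genus S a a↑∈ a∈ = begin
    genus (S ⊖ a)                            ≡⟨ cyclomatic-suc E′ V′ ⟨
    cyclomatic (suc E′) (suc V′)             ≡⟨ cong₂ cyclomatic (x∈p⇒∣p∣≡suc∣p[x]≔outside∣ a∈)
                                                                 (x∈p⇒∣p∣≡suc∣p[x]≔outside∣ a↑∈) ⟨
    genus S                                  ∎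
    where
    open ≡-Reasoning
    E′ = ∣ edges (S ⊖ a) ∣
    V′ = ∣ verts (S ⊖ a) ∣

  ⊖-isSubgraph : IsSubgraph S → Pendant S a → IsSubgraph (S ⊖ a)
  ⊖-isSubgraph {S} {a} S-sub (_ , unique) f f∈ =
    keep (proj₁ (S-sub f f∈S)) (λ eq → f≢ (cong edge (unique (f , false) (f∈S , eq)))) ,
    keep (proj₂ (S-sub f f∈S)) (λ eq → f≢ (cong edge (unique (f , true) (f∈S , eq))))
    where
    f∈S = x∈p[y]≔outside⇒x∈p f∈
    f≢ = x∈p[y]≔outside⇒x≢y f∈
    keep : ∀ {v} → v ∈ verts S → v ≢ init G a → v ∈ verts (S ⊖ a)
    keep v∈ v≢ = []≔-minimal (verts S) _ _ v≢ v∈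

  module _ {S : Subgraph G} {a : OEdge G} (pendant : Pendant S a) where

    avoid : Walk S u w → u ≢ init G a → w ≢ init G a → Walk (S ⊖ a) u w
    avoid-from : Walk S u w → u ≡ init G a → w ≢ init G a → Walk (S ⊖ a) (term G a) w

    avoid here _ _ = here
    avoid (step b b∈ W) b↑≢ w≢ with edge b Fin.≟ edge a
    ... | no differ = step b ([]≔-minimal (edges S) _ _ differ b∈) (avoid W b↓≢ w≢)
      where
      b↓≢ : term G b ≢ init G a
      b↓≢ b↓ = differ (cong edge (proj₂ pendant (b ⁻¹) (b∈ , trans (init-⁻¹ b) b↓)))
    ... | yes same with same-edge a b same
    ...   | inj₁ refl = contradiction refl b↑≢
    ...   | inj₂ refl = subst (λ t → Walk (S ⊖ a) t _) (sym (init-⁻¹ a)) (avoid-from W (term-⁻¹ a) w≢)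

    avoid-from here u≡ w≢ = contradiction u≡ w≢
    avoid-from (step b b∈ W) b↑ w≢ with refl ← proj₂ pendant b (b∈ , b↑) =
      avoid W (pendant-loopless S a pendant) w≢

  ⊖-connected : IsSubgraph S → Connected S → Pendant S a → Connected (S ⊖ a)
  ⊖-connected {S} {a} S-sub S-conn pendant@(a∈ , _) =
    (term G a , []≔-minimal (verts S) _ _ (pendant-loopless S a pendant) (proj₂ (ends-∈ S-sub a a∈))) ,
    λ u v u∈ v∈ → avoid pendant (proj₂ S-conn u v (x∈p[y]≔outside⇒x∈p u∈) (x∈p[y]≔outside⇒x∈p v∈))
                               (x∈p[y]≔outside⇒x≢y u∈) (x∈p[y]≔outside⇒x≢y v∈)

  ⊖-keeps : IsSubgraph K → MinDegree≥2 K → K ⊑ S → Pendant S a → K ⊑ S ⊖ a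
  ⊖-keeps {K} {S} {a} K-sub K-deg (V⊆ , E⊆) (_ , unique) =
    (λ v∈ → []≔-minimal (verts S) _ _ (λ { refl → a↑∉ v∈ }) (V⊆ v∈)) ,
    (λ f∈ → []≔-minimal (edges S) _ _ (λ { refl → a↑∉ (proj₁ (ends-∈ K-sub a f∈)) }) (E⊆ f∈))
    where
    a↑∉ : init G a ∉ verts K
    a↑∉ a↑∈ with b , b′ , b≢b′ , (b∈ , b↑) , (b′∈ , b′↑) ← K-deg _ a↑∈ =
      b≢b′ (trans (unique b (E⊆ b∈ , b↑)) (sym (unique b′ (E⊆ b′∈ , b′↑))))

  record PruneInvariant (S : Subgraph G) : Set where
    field
      isSubgraph : IsSubgraph S
      connected : Connected S
      full-genus : genus S ≡ genus (whole G)
      ⊒good : ∀ (K : Subgraph G) → GoodSub G K → K ⊑ S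

  open PruneInvariant public

  whole-invariant : Connected (whole G) → PruneInvariant (whole G)
  whole-invariant G-conn = record
    { isSubgraph = λ _ _ → ∈⊤ , ∈⊤
    ; connected = G-conn
    ; full-genus = refl
    ; ⊒good = λ _ _ → (λ _ → ∈⊤) , (λ _ → ∈⊤)
    }

  module _ (G≥2 : + 2 ≤ genus (whole G)) where

    full-genus⇒V<E : ∀ (S : Subgraph G) → genus S ≡ genus (whole G) → ∣ verts S ∣ < ∣ edges S ∣
    full-genus⇒V<E S S-genus = 2≤cyclomatic⇒< ∣ edges S ∣ ∣ verts S ∣ (subst (+ 2 ≤_) (sym S-genus) G≥2)

    full-genus⇒edge : ∀ (S : Subgraph G) → genus S ≡ genus (whole G) → Nonempty (edges S)
    full-genus⇒edge S S-genus = 0<∣p∣⇒nonempty (ℕ.m<n⇒0<n (full-genus⇒V<E S S-genus))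

    good⇒minDegree≥2 : ∀ (K : Subgraph G) → GoodSub G K → MinDegree≥2 K
    good⇒minDegree≥2 K (K-sub , K-conn , K-genus , K-ewc) =
      edgeWalkConnected⇒minDegree≥2 K K-sub K-conn (full-genus⇒edge K K-genus) K-ewc

    ⊖-invariant : PruneInvariant S → Pendant S a → PruneInvariant (S ⊖ a)
    ⊖-invariant {S} {a} I pendant@(a∈ , _) = record
      { isSubgraph = ⊖-isSubgraph (isSubgraph I) pendant
      ; connected = ⊖-connected (isSubgraph I) (connected I) pendant
      ; full-genus = trans (⊖-genus S a (proj₁ (ends-∈ (isSubgraph I) a a∈)) a∈) (full-genus I)
      ; ⊒good = λ K good → ⊖-keeps (proj₁ good) (good⇒minDegree≥2 K good) (⊒good I K good) pendant
      }

    minDegree≥2⊎pendant : PruneInvariant S → MinDegree≥2 S ⊎ ∃ (Pendant S)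
    minDegree≥2⊎pendant {S} I with Fin.any? (λ v → (v ∈? verts S) ×-dec ¬? (degree≥2? S v))
    ... | no none = inj₁ λ v v∈ → decidable-stable (degree≥2? S v) (λ ¬deg → none (v , v∈ , ¬deg))
    ... | yes (v , v∈ , ¬deg)
      with e , e∈ ← full-genus⇒edge S (full-genus I)
      with a , a-leaves ← leaving-edge S (isSubgraph I) (connected I) e∈ v∈
      = inj₂ (a , ¬degree≥2⇒pendant S ¬deg a-leaves)

    prune : ∀ (S : Subgraph G) → Acc _<_ ∣ verts S ∣ → PruneInvariant S →
      Σ (Subgraph G) λ H → PruneInvariant H × MinDegree≥2 H
    prune S (acc smaller) I with minDegree≥2⊎pendant I
    ... | inj₁ S-deg = S , I , S-deg
    ... | inj₂ (a , pendant) =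
      prune (S ⊖ a) (smaller (⊖-shrinks S a (proj₁ (ends-∈ (isSubgraph I) a (proj₁ pendant)))))
            (⊖-invariant I pendant)

  _⊕_ : Subgraph G → OEdge G → Subgraph G
  K ⊕ c = sub (verts K [ term G c ]≔ inside) (edges K [ edge c ]≔ inside)

  ⊕-isSubgraph : ∀ (K : Subgraph G) c → IsSubgraph K → init G c ∈ verts K → IsSubgraph (K ⊕ c)
  ⊕-isSubgraph K c K-sub c↑∈ f f∈ with x∈p[y]≔inside⇒x≡y⊎x∈p f∈
  ... | inj₁ refl = ∈-ends c (p⊆p[x]≔inside c↑∈) ([]≔-updates (verts K) (term G c))
  ... | inj₂ f∈K = Product.map p⊆p[x]≔inside p⊆p[x]≔inside (K-sub f f∈K)

  ⊕-⊑ : ∀ (K : Subgraph G) c → IsSubgraph H → K ⊑ H → c ∈ₑ H → K ⊕ c ⊑ H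
  ⊕-⊑ K c H-sub (V⊆ , E⊆) c∈ =
    (λ v∈ → [ (λ { refl → proj₂ (ends-∈ H-sub c c∈) }) , V⊆ ]′ (x∈p[y]≔inside⇒x≡y⊎x∈p v∈)) ,
    (λ f∈ → [ (λ { refl → c∈ }) , E⊆ ]′ (x∈p[y]≔inside⇒x≡y⊎x∈p f∈))

  ⊕-genus-closing : ∀ (K : Subgraph G) c → edge c ∉ edges K → term G c ∈ verts K →
    genus (K ⊕ c) ≡ ℤ.suc (genus K)
  ⊕-genus-closing K c c∉ c↓∈ = begin
    genus (K ⊕ c)                          ≡⟨ cong₂ cyclomatic (x∉p⇒∣p[x]≔inside∣≡suc∣p∣ c∉)
                                                             (cong ∣_∣ (x∈p⇒p[x]≔inside≡p c↓∈)) ⟩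
    cyclomatic (suc ∣ edges K ∣) ∣ verts K ∣ ≡⟨ cyclomatic-sucˡ ∣ edges K ∣ ∣ verts K ∣ ⟩
    ℤ.suc (genus K)                        ∎
    where open ≡-Reasoning

  ⊕-genus-pendant : ∀ (K : Subgraph G) c → edge c ∉ edges K → term G c ∉ verts K →
    genus (K ⊕ c) ≡ genus K
  ⊕-genus-pendant K c c∉ c↓∉ = begin
    genus (K ⊕ c)                                  ≡⟨ cong₂ cyclomatic (x∉p⇒∣p[x]≔inside∣≡suc∣p∣ c∉)
                                                                     (x∉p⇒∣p[x]≔inside∣≡suc∣p∣ c↓∉) ⟩
    cyclomatic (suc ∣ edges K ∣) (suc ∣ verts K ∣) ≡⟨ cyclomatic-suc ∣ edges K ∣ ∣ verts K ∣ ⟩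
    genus K                                        ∎
    where open ≡-Reasoning

  module _ {H : Subgraph G} (H-sub : IsSubgraph H) (H-conn : Connected H) (H-deg : MinDegree≥2 H) where

    Exit : Subgraph G → Set
    Exit K = ∃ λ c → c ∈ₑ H × edge c ∉ edges K × init G c ∈ verts K

    exit-along : IsSubgraph K → Walk H u w → u ∈ verts K → w ∉ verts K → Exit K
    exit-along K-sub here u∈ u∉ = contradiction u∈ u∉
    exit-along {K} K-sub (step c c∈ W) c↑∈ w∉ with edge c ∈? edges K
    ... | yes c∈K = exit-along K-sub W (proj₂ (ends-∈ K-sub c c∈K)) w∉
    ... | no c∉K = c , c∈ , c∉K , c↑∈

    spanned⊎exit : IsSubgraph K → K ⊑ H → v ∈ verts K → H ⊑ K ⊎ Exit K
    spanned⊎exit {K} K-sub K⊑H v∈ with p⊆q⊎∃∈p∉q (verts H) (verts K)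
    ... | inj₂ (u , u∈H , u∉K) = inj₂ (exit-along K-sub (proj₂ H-conn _ u (proj₁ K⊑H v∈) u∈H) v∈ u∉K)
    ... | inj₁ V⊆ with p⊆q⊎∃∈p∉q (edges H) (edges K)
    ...   | inj₁ E⊆ = inj₁ (V⊆ , E⊆)
    ...   | inj₂ (e , e∈H , e∉K) = inj₂ ((e , false) , e∈H , e∉K , V⊆ (proj₁ (H-sub e e∈H)))

    ⊕-pendant-¬spanning : ∀ (K : Subgraph G) c → IsSubgraph K → c ∈ₑ H →
      init G c ∈ verts K → term G c ∉ verts K → ¬ (H ⊑ K ⊕ c)
    ⊕-pendant-¬spanning K c K-sub c∈ c↑∈ c↓∉ (_ , E⊆)
      with b , b′ , b≢b′ , b-leaves , b′-leaves ← H-deg _ (proj₂ (ends-∈ H-sub c c∈))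
      = b≢b′ (trans (forced b b-leaves) (sym (forced b′ b′-leaves)))
      where
      forced : ∀ d → Leaves H (term G c) d → d ≡ c ⁻¹
      forced d (d∈ , d↑) with x∈p[y]≔inside⇒x≡y⊎x∈p (E⊆ d∈)
      ... | inj₂ d∈K = contradiction (subst (_∈ verts K) d↑ (proj₁ (ends-∈ K-sub d d∈K))) c↓∉
      ... | inj₁ same with same-edge c d same
      ...   | inj₁ refl = contradiction (subst (_∈ verts K) d↑ c↑∈) c↓∉
      ...   | inj₂ d≡c⁻¹ = d≡c⁻¹

    ⊕-genus< : ∀ (K : Subgraph G) c → IsSubgraph K → K ⊑ H → c ∈ₑ H →
      edge c ∉ edges K → init G c ∈ verts K →
      H ⊑ K ⊕ c ⊎ genus (K ⊕ c) ℤ.< genus H → genus K ℤ.< genus H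
    ⊕-genus< K c K-sub K⊑H c∈ c∉K c↑∈ K⊕c-dichotomy with term G c ∈? verts K
    ... | yes c↓∈ = begin-strict
      genus K         <⟨ ℤ.suc[i]≤j⇒i<j ℤ.≤-refl ⟩
      ℤ.suc (genus K) ≡⟨ ⊕-genus-closing K c c∉K c↓∈ ⟨
      genus (K ⊕ c)   ≤⟨ K⊕c≤H K⊕c-dichotomy ⟩
      genus H         ∎
      where
      open ℤ.≤-Reasoning
      K⊕c≤H : H ⊑ K ⊕ c ⊎ genus (K ⊕ c) ℤ.< genus H → genus (K ⊕ c) ≤ genus H
      K⊕c≤H (inj₁ H⊑K⊕c) = ℤ.≤-reflexive (cong genus (⊑-antisym (⊕-⊑ K c H-sub K⊑H c∈) H⊑K⊕c))
      K⊕c≤H (inj₂ K⊕c<H) = ℤ.<⇒≤ K⊕c<H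
    ... | no c↓∉ with K⊕c-dichotomy
    ...   | inj₁ H⊑K⊕c = contradiction H⊑K⊕c (⊕-pendant-¬spanning K c K-sub c∈ c↑∈ c↓∉)
    ...   | inj₂ K⊕c<H = subst (ℤ._< genus H) (⊕-genus-pendant K c c∉K c↓∉) K⊕c<H

    H⊑K⊎genus< : IsSubgraph K → K ⊑ H → v ∈ verts K → H ⊑ K ⊎ genus K ℤ.< genus H
    H⊑K⊎genus< = grow _ (<-wellFounded _)
      where
      grow : ∀ K → Acc _<_ (∣ edges H ∣ ∸ ∣ edges K ∣) → IsSubgraph K → K ⊑ H → v ∈ verts K →
        H ⊑ K ⊎ genus K ℤ.< genus H
      grow K (acc smaller) K-sub K⊑H v∈ with spanned⊎exit K-sub K⊑H v∈
      ... | inj₁ H⊑K = inj₁ H⊑K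
      ... | inj₂ (c , c∈ , c∉K , c↑∈) = inj₂ (⊕-genus< K c K-sub K⊑H c∈ c∉K c↑∈ K⊕c-dichotomy)
        where
        K⊕c⊑H = ⊕-⊑ K c H-sub K⊑H c∈
        fewer-missing : ∣ edges H ∣ ∸ ∣ edges (K ⊕ c) ∣ < ∣ edges H ∣ ∸ ∣ edges K ∣
        fewer-missing = ℕ.∸-monoʳ-< (ℕ.≤-reflexive (sym (x∉p⇒∣p[x]≔inside∣≡suc∣p∣ c∉K)))
                                    (p⊆q⇒∣p∣≤∣q∣ (proj₂ K⊕c⊑H))
        K⊕c-dichotomy = grow (K ⊕ c) (smaller fewer-missing) (⊕-isSubgraph K c K-sub c↑∈) K⊕c⊑H
                             (p⊆p[x]≔inside v∈)

lemma4p14 : (G : Graph) → Connected (whole G) → + 2 ≤ genus (whole G) →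
    Σ (Subgraph G) λ H → GoodSub G H × ((H' : Subgraph G) → GoodSub G H' → H' ≡ H)
lemma4p14 G G-conn G≥2 = H , H-good , unique
  where
  pruned = prune G G≥2 (whole G) (<-wellFounded _) (whole-invariant G G-conn)
  H = proj₁ pruned
  I = proj₁ (proj₂ pruned)
  H-deg = proj₂ (proj₂ pruned)
  H-sub = isSubgraph I
  H-conn = connected I

  H-good : GoodSub G H
  H-good = H-sub , H-conn , full-genus I ,
    minDegree≥2⇒edgeWalkConnected G H-sub H-conn (full-genus⇒V<E G G≥2 H (full-genus I)) H-deg

  unique : (H′ : Subgraph G) → GoodSub G H′ → H′ ≡ H
  unique H′ H′-good@(H′-sub , ((v , v∈) , _) , H′-genus , _)
    with H⊑K⊎genus< G H-sub H-conn H-deg H′-sub (⊒good I H′ H′-good) v∈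
  ... | inj₁ H⊑H′ = ⊑-antisym G (⊒good I H′ H′-good) H⊑H′
  ... | inj₂ H′<H = contradiction H′<H (ℤ.<-irrefl (trans H′-genus (sym (full-genus I))))
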